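{- Let $A_k=\{a_1,\dots,a_k\}$ with $1=a_1<a_2<\dots<a_k$ integers, and let $h_0$ be the smallest positive integer $h$ with $n(h)\ge a_k$. Then there exists an integer $h_2\ge h_0-1$ such that for every integer $h\ge h_2$: if $x$ is a gap at level $h$, then $x+a_k$ is a gap at level $h+1$.
   Context: For an integer $h\ge 0$, an integer $x\ge 0$ has an $h$-representation if $x=\sum_{i=1}^k c_ia_i$ with nonnegative integers $c_i$ and $\sum_i c_i\le h$. The $h$-range $n(h)$ is the largest integer $n$ such that every integer $0\le x\le n$ has an $h$-representation. An integer $x$ is a gap at level $h$ if $n(h)<x<ha_k$ and $x$ has no $h$-representation. -}

module Defs where

open import Data.Nat using (ℕ; suc; _+_; _*_; _≤_; _<_)
open import Data.Fin as Fin using (Fin)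
open import Data.Vec using (Vec; sum; zipWith; lookup; head; last)
open import Data.Product using (Σ; ∃; _×_)
open import Relation.Nullary using (¬_)
open import Relation.Binary.PropositionalEquality using (_≡_)

-- A_k = {a_1 < a_2 < ... < a_k} with a_1 = 1, as a vector of length k = suc m
-- (entry i is a_{i+1}).
IsBasis : {m : ℕ} → Vec ℕ (suc m) → Set
IsBasis a = (head a ≡ 1) × (∀ (i j : Fin _) → i Fin.< j → lookup a i < lookup a j)

aₖ : {m : ℕ} → Vec ℕ (suc m) → ℕ
aₖ a = last a

HRep : {m : ℕ} → Vec ℕ (suc m) → ℕ → ℕ → Set
HRep {m} a h x = Σ (Vec ℕ (suc m)) λ c → (sum c ≤ h) × (sum (zipWith _*_ c a) ≡ x)

AllRep : {m : ℕ} → Vec ℕ (suc m) → ℕ → ℕ → Set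
AllRep a h n = ∀ y → y ≤ n → HRep a h y

IsRange : {m : ℕ} → Vec ℕ (suc m) → ℕ → ℕ → Set
IsRange a h N = AllRep a h N × (∀ M → AllRep a h M → M ≤ N)

Gap : {m : ℕ} → Vec ℕ (suc m) → ℕ → ℕ → Set
Gap a h x = ∃ λ N → IsRange a h N × (N < x) × (x < h * aₖ a) × ¬ HRep a h x

IsH₀ : {m : ℕ} → Vec ℕ (suc m) → ℕ → Set
IsH₀ a h₀ = (1 ≤ h₀)
          × (∃ λ N → IsRange a h₀ N × (aₖ a ≤ N))
          × (∀ h → 1 ≤ h → h < h₀ → ¬ (∃ λ N → IsRange a h N × (aₖ a ≤ N)))

module Submission where

-- Write B = a_k and let x be a gap at level h.  If x + B
-- had an (h+1)-representation Σ c_i a_i, two cases arise.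
--   * Some c_i ≥ B.  Trading B copies of a_i for a_i copies of a_k keeps the
--     value, and then dropping one copy of a_k represents x with at most
--     (a_i - 1) + (h + 1 - B) ≤ h summands, contradicting that x is a gap.
--   * Every c_i < B.  Then the value is at most k·B², which is impossible once
--     x > k·B²; this holds for h ≥ h₂ = h₀ + k·B² because 1 ∈ A_k forces
--     x > n(h) ≥ h.
-- So x + B is not (h+1)-representable and x + B < (h+1)·B.  Every such number
-- is a gap at level h+1, since representability is decidable and hence the
-- range n(h+1) exists (as the last number before the first failure).

open import Defs
open import Data.Nat using (ℕ; zero; suc; _+_; _*_; _∸_; _≤_; _<_; z≤n; s≤s; s≤s⁻¹; z<s; _≟_; _≤?_)
open import Data.Nat.Properties
open import Data.Fin as Fin using (Fin; fromℕ)
open import Data.Fin.Properties using (any?; ≤fromℕ) renaming (≤∧≢⇒< to ≤∧≢⇒<ᶠ)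
open import Data.Vec using (Vec; []; _∷_; sum; zipWith; lookup; head; last; replicate)
open import Data.Product using (Σ; ∃; _×_; _,_; proj₁; proj₂)
open import Data.Sum using (_⊎_; inj₁; inj₂)
open import Relation.Nullary using (¬_; Dec; yes; no; contradiction)
open import Relation.Nullary.Decidable using (map′; _×-dec_)
open import Relation.Unary using (Decidable)
open import Relation.Binary.PropositionalEquality
open import Algebra.Properties.CommutativeSemigroup +-commutativeSemigroup using (x∙yz≈y∙xz)

_·_ : ∀ {n} → Vec ℕ n → Vec ℕ n → ℕ
c · a = sum (zipWith _*_ c a)

Rep : ∀ {n} → Vec ℕ n → ℕ → ℕ → Set
Rep {n} a h x = Σ (Vec ℕ n) λ c → (sum c ≤ h) × (c · a ≡ x)

addAt : ∀ {n} → Fin n → ℕ → Vec ℕ n → Vec ℕ n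
addAt Fin.zero    d (c ∷ cs) = d + c ∷ cs
addAt (Fin.suc i) d (c ∷ cs) = c ∷ addAt i d cs

sum-addAt : ∀ {n} (i : Fin n) d c → sum (addAt i d c) ≡ d + sum c
sum-addAt Fin.zero    d (c ∷ cs) = +-assoc d c (sum cs)
sum-addAt (Fin.suc i) d (c ∷ cs) = trans (cong (c +_) (sum-addAt i d cs)) (x∙yz≈y∙xz c d (sum cs))

·-addAt : ∀ {n} (i : Fin n) d c (a : Vec ℕ n) → addAt i d c · a ≡ d * lookup a i + c · a
·-addAt Fin.zero    d (c ∷ cs) (a ∷ as) =
  trans (cong (_+ cs · as) (*-distribʳ-+ a d c)) (+-assoc (d * a) (c * a) (cs · as))
·-addAt (Fin.suc i) d (c ∷ cs) (a ∷ as) =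
  trans (cong (c * a +_) (·-addAt i d cs as)) (x∙yz≈y∙xz (c * a) (d * lookup as i) (cs · as))

split-addAt : ∀ {n} (c : Vec ℕ n) (i : Fin n) d → d ≤ lookup c i → ∃ λ c′ → c ≡ addAt i d c′
split-addAt (c ∷ cs) Fin.zero    d d≤c = c ∸ d ∷ cs , cong (_∷ cs) (sym (m+[n∸m]≡n d≤c))
split-addAt (c ∷ cs) (Fin.suc i) d d≤c with split-addAt cs i d d≤c
... | c′ , refl = c ∷ c′ , refl

sum-zeros : ∀ n → sum (replicate n 0) ≡ 0
sum-zeros zero    = refl
sum-zeros (suc n) = sum-zeros n

·-zeros : ∀ {n} (a : Vec ℕ n) → replicate n 0 · a ≡ 0
·-zeros []       = refl
·-zeros (_ ∷ as) = ·-zeros as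

multiple-rep : ∀ {n} (a : Vec ℕ n) (i : Fin n) {h} d → d ≤ h → Rep a h (d * lookup a i)
multiple-rep {n} a i {h} d d≤h = addAt i d zeros , count , value
  where
  zeros : Vec ℕ n
  zeros = replicate n 0
  count : sum (addAt i d zeros) ≤ h
  count rewrite sum-addAt i d zeros | sum-zeros n | +-identityʳ d = d≤h
  value : addAt i d zeros · a ≡ d * lookup a i
  value rewrite ·-addAt i d zeros a | ·-zeros a = +-identityʳ (d * lookup a i)

·-bound : ∀ {n} (c a : Vec ℕ n) B →
  (∀ i → lookup c i ≤ B) → (∀ i → lookup a i ≤ B) → c · a ≤ n * (B * B)
·-bound []       []       B _  _  = z≤n
·-bound (c ∷ cs) (a ∷ as) B cB aB =
  +-mono-≤ (*-mono-≤ (cB Fin.zero) (aB Fin.zero))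
           (·-bound cs as B (λ i → cB (Fin.suc i)) (λ i → aB (Fin.suc i)))

FirstCoefficient : ∀ {n} → ℕ → Vec ℕ n → ℕ → ℕ → ℕ → Set
FirstCoefficient a₀ as h x c₀ = (c₀ * a₀ ≤ x) × Rep as (h ∸ c₀) (x ∸ c₀ * a₀)

rep-cons : ∀ {n} a₀ (as : Vec ℕ n) h x →
  (∃ λ c₀ → c₀ < suc h × FirstCoefficient a₀ as h x c₀) → Rep (a₀ ∷ as) h x
rep-cons a₀ as h x (c₀ , c₀≤h , c₀a₀≤x , c , count , value) =
  c₀ ∷ c ,
  ≤-trans (+-monoʳ-≤ c₀ count) (≤-reflexive (m+[n∸m]≡n (s≤s⁻¹ c₀≤h))) ,
  trans (cong (c₀ * a₀ +_) value) (m+[n∸m]≡n c₀a₀≤x)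

rep-uncons : ∀ {n} a₀ (as : Vec ℕ n) h x →
  Rep (a₀ ∷ as) h x → ∃ λ c₀ → c₀ < suc h × FirstCoefficient a₀ as h x c₀
rep-uncons a₀ as h x (c₀ ∷ c , count , value) =
  c₀ , s≤s (≤-trans (m≤m+n c₀ (sum c)) count) , subst (c₀ * a₀ ≤_) value (m≤m+n _ _) ,
  c ,
  subst (_≤ h ∸ c₀) (m+n∸m≡n c₀ (sum c)) (∸-monoˡ-≤ c₀ count) ,
  trans (sym (m+n∸m≡n (c₀ * a₀) (c · as))) (cong (_∸ c₀ * a₀) value)

rep? : ∀ {n} (a : Vec ℕ n) h x → Dec (Rep a h x)
rep? []        h x = map′ (λ { refl → [] , z≤n , refl }) (λ { ([] , _ , value) → sym value }) (x ≟ 0)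
rep? (a₀ ∷ as) h x = map′ (rep-cons a₀ as h x) (rep-uncons a₀ as h x)
  (anyUpTo? (λ c₀ → (c₀ * a₀ ≤? x) ×-dec rep? as (h ∸ c₀) (x ∸ c₀ * a₀)) (suc h))

module FirstFailure {P : ℕ → Set} (P? : Decidable P) where

  UpTo : ℕ → Set
  UpTo N = ∀ y → y ≤ N → P y

  first-failure : ∀ z → UpTo z ⊎ (∃ λ w → ¬ P w × (∀ y → y < w → P y))
  first-failure zero with P? zero
  ... | yes P0 = inj₁ λ { zero _ → P0 }
  ... | no ¬P0 = inj₂ (zero , ¬P0 , λ _ ())
  first-failure (suc z) with first-failure z | P? (suc z)
  ... | inj₂ failure | _       = inj₂ failure
  ... | inj₁ upTo    | no ¬Pz′ = inj₂ (suc z , ¬Pz′ , λ y y<z′ → upTo y (s≤s⁻¹ y<z′))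
  ... | inj₁ upTo    | yes Pz′ = inj₁ extended
    where
    extended : UpTo (suc z)
    extended y y≤z′ with m≤n⇒m<n∨m≡n y≤z′
    ... | inj₁ y<z′ = upTo y (s≤s⁻¹ y<z′)
    ... | inj₂ refl = Pz′

  largest-initial-segment : ∀ z → P 0 → ¬ P z →
    ∃ λ N → (UpTo N × (∀ M → UpTo M → M ≤ N)) × N < z
  largest-initial-segment z P0 ¬Pz with first-failure z
  ... | inj₁ upTo                   = contradiction (upTo z ≤-refl) ¬Pz
  ... | inj₂ (zero  , ¬P0 , _)      = contradiction P0 ¬P0
  ... | inj₂ (suc N , ¬PN′ , below) = N , (upTo , maximal) , ≰⇒> (λ z≤N → ¬Pz (upTo z z≤N))
    where
    upTo : UpTo N
    upTo y y≤N = below y (s≤s y≤N)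
    maximal : ∀ M → UpTo M → M ≤ N
    maximal M upToM = ≮⇒≥ (λ N<M → ¬PN′ (upToM (suc N) N<M))

range-below : ∀ {m} (a : Vec ℕ (suc m)) h z → ¬ HRep a h z → ∃ λ N → IsRange a h N × N < z
range-below a h z = largest-initial-segment z (multiple-rep a Fin.zero 0 z≤n)
  where open FirstFailure (rep? a h)

gap-of-nonrep : ∀ {m} (a : Vec ℕ (suc m)) h x → x < h * aₖ a → ¬ HRep a h x → Gap a h x
gap-of-nonrep a h x x<hB ¬rep with range-below a h x ¬rep
... | N , range , N<x = N , range , N<x , x<hB , ¬rep

last≡lookup-fromℕ : ∀ {A : Set} {m} (a : Vec A (suc m)) → last a ≡ lookup a (fromℕ m)
last≡lookup-fromℕ {m = zero}  (_ ∷ []) = refl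
last≡lookup-fromℕ {m = suc m} (_ ∷ as) = last≡lookup-fromℕ as

module Basis {m : ℕ} (a : Vec ℕ (suc m)) (basis : IsBasis a) where

  first≡1 : lookup a Fin.zero ≡ 1
  first≡1 = head-is-first a (proj₁ basis)
    where
    head-is-first : ∀ {m} (v : Vec ℕ (suc m)) → head v ≡ 1 → lookup v Fin.zero ≡ 1
    head-is-first (_ ∷ _) head≡1 = head≡1

  positive : ∀ i → 1 ≤ lookup a i
  positive Fin.zero    = ≤-reflexive (sym first≡1)
  positive (Fin.suc i) =
    <⇒≤ (subst (_< lookup a (Fin.suc i)) first≡1 (proj₂ basis Fin.zero (Fin.suc i) z<s))

  ≤-aₖ : ∀ i → lookup a i ≤ aₖ a
  ≤-aₖ i = subst (lookup a i ≤_) (sym (last≡lookup-fromℕ a)) (below-last i)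
    where
    below-last : ∀ i → lookup a i ≤ lookup a (fromℕ m)
    below-last i with i Fin.≟ fromℕ m
    ... | yes refl   = ≤-refl
    ... | no  i≢last = <⇒≤ (proj₂ basis i (fromℕ m) (≤∧≢⇒<ᶠ (≤fromℕ i) i≢last))

  -- Since 1 ∈ A_k, every y ≤ h is h-representable, so n(h) ≥ h.
  range≥level : ∀ {h N} → IsRange a h N → h ≤ N
  range≥level {h} (_ , maximal) = maximal h λ y y≤h →
    subst (Rep a h) (trans (cong (y *_) first≡1) (*-identityʳ y)) (multiple-rep a Fin.zero y y≤h)

-- Arithmetic core of the exchange: with 1 ≤ aᵢ ≤ B, replacing B copies of aᵢ by
-- aᵢ - 1 copies of B lowers the value by exactly B and the count by at least 1.
trade : ∀ {aᵢ B s h D x} → 1 ≤ aᵢ → aᵢ ≤ B → B + s ≤ suc h → B * aᵢ + D ≡ x + B →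
  (aᵢ ∸ 1 + s ≤ h) × ((aᵢ ∸ 1) * B + D ≡ x)
trade {aᵢ = suc k} {B} {s} {D = D} {x = x} _ aᵢ≤B count value =
  s≤s⁻¹ (≤-trans (+-monoˡ-≤ s aᵢ≤B) count) , +-cancelˡ-≡ B _ _ shifted
  where
  open ≡-Reasoning
  shifted : B + (k * B + D) ≡ B + x
  shifted = begin
    B + (k * B + D)   ≡⟨ sym (+-assoc B (k * B) D) ⟩
    suc k * B + D     ≡⟨ cong (_+ D) (*-comm (suc k) B) ⟩
    B * suc k + D     ≡⟨ value ⟩
    x + B             ≡⟨ +-comm x B ⟩
    B + x             ∎

module Exchange {n} (a : Vec ℕ n) (B : ℕ) (t : Fin n) (a-t : lookup a t ≡ B)
                (positive : ∀ i → 1 ≤ lookup a i) (≤-B : ∀ i → lookup a i ≤ B) where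

  trade-rep : ∀ {h x} c i → B ≤ lookup c i → sum c ≤ suc h → c · a ≡ x + B → Rep a h x
  trade-rep {h} {x} c i B≤cᵢ count value with split-addAt c i B B≤cᵢ
  ... | c′ , refl = addAt t (aᵢ ∸ 1) c′ , count′ , value′
    where
    aᵢ : ℕ
    aᵢ = lookup a i
    traded : (aᵢ ∸ 1 + sum c′ ≤ h) × ((aᵢ ∸ 1) * B + c′ · a ≡ x)
    traded = trade (positive i) (≤-B i) (subst (_≤ suc h) (sum-addAt i B c′) count)
                   (trans (sym (·-addAt i B c′ a)) value)
    count′ : sum (addAt t (aᵢ ∸ 1) c′) ≤ h
    count′ = subst (_≤ h) (sym (sum-addAt t (aᵢ ∸ 1) c′)) (proj₁ traded)
    value′ : addAt t (aᵢ ∸ 1) c′ · a ≡ x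
    value′ = trans (·-addAt t (aᵢ ∸ 1) c′ a)
                   (trans (cong (λ b → (aᵢ ∸ 1) * b + c′ · a) a-t) (proj₂ traded))

  shift-nonrep : ∀ {h x} → n * (B * B) ≤ x → ¬ Rep a h x → ¬ Rep a (suc h) (x + B)
  shift-nonrep {x = x} large ¬rep (c , count , value) with any? (λ i → B ≤? lookup c i)
  ... | yes (i , B≤cᵢ) = ¬rep (trade-rep c i B≤cᵢ count value)
  ... | no  noLarge    = <⇒≱ (m<m+n x B>0) (≤-trans (subst (_≤ n * (B * B)) value bounded) large)
    where
    B>0 : 0 < B
    B>0 = subst (1 ≤_) a-t (positive t)
    bounded : c · a ≤ n * (B * B)
    bounded = ·-bound c a B (λ i → <⇒≤ (≰⇒> λ B≤cᵢ → noLarge (i , B≤cᵢ))) ≤-B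

-- Theorem 3: with h₂ = h₀ + k·a_k², for h ≥ h₂ every gap x at level h gives
-- the gap x + a_k at level h + 1.
theorem3 : ∀ {m : ℕ} (a : Vec ℕ (suc m)) → IsBasis a → ∀ (h₀ : ℕ) → IsH₀ a h₀ →
    ∃ λ h₂ → (h₀ ∸ 1 ≤ h₂) × (∀ h → h₂ ≤ h → ∀ x → Gap a h x → Gap a (suc h) (x + aₖ a))
theorem3 {m} a basis h₀ _ = h₂ , ≤-trans (m∸n≤m h₀ 1) (m≤m+n h₀ _) , shift
  where
  open Basis a basis
  B : ℕ
  B = aₖ a
  open Exchange a B (fromℕ m) (sym (last≡lookup-fromℕ a)) positive ≤-aₖ
  h₂ : ℕ
  h₂ = h₀ + suc m * (B * B)

  shift : ∀ h → h₂ ≤ h → ∀ x → Gap a h x → Gap a (suc h) (x + B)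
  shift h h₂≤h x (N , range , N<x , x<hB , ¬rep) =
    gap-of-nonrep a (suc h) (x + B) x+B<[h+1]B (shift-nonrep large ¬rep)
    where
    -- x > n(h) ≥ h ≥ h₂ ≥ k·B²
    large : suc m * (B * B) ≤ x
    large = ≤-trans (m≤n+m _ h₀) (≤-trans h₂≤h (<⇒≤ (≤-<-trans (range≥level range) N<x)))
    x+B<[h+1]B : x + B < suc h * B
    x+B<[h+1]B = subst (x + B <_) (+-comm (h * B) B) (+-monoˡ-< B x<hB)
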